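{- Let $p(n,k)$ be the number of $\mathbf{3}$-free naturally labelled posets on $[n]$ with exactly $k$ minimal elements. Then $p(0,0)=1$, $p(n,0)=0$ for $n\geq1$, $p(n,k)=0$ for $n<k$, and for $n,k\geq 1$ $$p(n,k)=p(n-1,k-1)+(2^k-1)\,p(n-1,k).$$ Consequently $p(n,k)=S_2[n,k]$ for all $n,k\ge 0$, where $S_q[n,k]$ are the $q$-Stirling numbers of the second kind. Moreover, the bivariate generating function $F(z,y)=\sum_{n\geq k\geq 0}p(n,k)z^ny^k$ satisfies $$F(z,y)=1+z\big(F(z,2y)-(1-y)F(z,y)\big),$$ and $$F(z,y)=\sum_{k\geq 0}\frac{z^ky^k}{\prod_{i=1}^k\big(1-(2^i-1)z\big)}.$$
   Context: A partial order $\preceq$ on $[n]$ is naturally labelled if $x\prec y$ implies $x<y$; it is $\mathbf{3}$-free if it has no chain $x\prec y\prec z$. The ($q$-Stirling numbers of the second kind, Carlitz) $S_q[n,k]$ are defined by $S_q[0,0]=1$, $S_q[n,0]=0$ for $n\ge1$, $S_q[n,k]=0$ for $k>n$, and $S_q[n,k]=S_q[n-1,k-1]+[k]_q\,S_q[n-1,k]$ where $[k]_q=1+q+\dots+q^{k-1}$. -}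

module Defs where

open import Data.Nat as ℕ using (ℕ; zero; suc; _∸_; _≡ᵇ_)
open import Data.Nat.Base using (_^_)
open import Data.Integer as ℤ using (ℤ; +_; 0ℤ; 1ℤ)
open import Data.Bool using (Bool; true; false; if_then_else_; _∧_)
import Data.Bool.Properties as BoolP
open import Data.Fin using (Fin; toℕ)
import Data.Fin.Properties as FinP
open import Data.Vec using (Vec; []; _∷_; lookup)
open import Data.List using (List; allFin; []; _∷_; map; concatMap; filter; length)
open import Data.Product using (_×_; _,_)
open import Data.Empty using (⊥)
open import Relation.Nullary using (Dec; no; ¬_; ¬?)
open import Relation.Nullary.Decidable using (_×-dec_; _→-dec_)
open import Relation.Binary.PropositionalEquality using (_≡_; _≢_)

Rel : ℕ → Set
Rel n = Vec (Vec Bool n) n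

_⊢_≼_ : ∀ {n} → Rel n → Fin n → Fin n → Set
R ⊢ i ≼ j = lookup (lookup R i) j ≡ true

_⊢_≺_ : ∀ {n} → Rel n → Fin n → Fin n → Set
R ⊢ i ≺ j = (R ⊢ i ≼ j) × (i ≢ j)

IsPartialOrder : ∀ {n} → Rel n → Set
IsPartialOrder R =
  (∀ i → R ⊢ i ≼ i) ×
  (∀ i j → R ⊢ i ≼ j → R ⊢ j ≼ i → i ≡ j) ×
  (∀ i j k → R ⊢ i ≼ j → R ⊢ j ≼ k → R ⊢ i ≼ k)

NaturallyLabelled : ∀ {n} → Rel n → Set
NaturallyLabelled R = ∀ i j → R ⊢ i ≺ j → toℕ i ℕ.< toℕ j

ThreeFree : ∀ {n} → Rel n → Set
ThreeFree R = ∀ i j k → R ⊢ i ≺ j → R ⊢ j ≺ k → ⊥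

Minimal : ∀ {n} → Rel n → Fin n → Set
Minimal R x = ∀ y → ¬ (R ⊢ y ≺ x)

≼? : ∀ {n} (R : Rel n) i j → Dec (R ⊢ i ≼ j)
≼? R i j = lookup (lookup R i) j BoolP.≟ true

≺? : ∀ {n} (R : Rel n) i j → Dec (R ⊢ i ≺ j)
≺? R i j = ≼? R i j ×-dec ¬? (i FinP.≟ j)

isPartialOrder? : ∀ {n} (R : Rel n) → Dec (IsPartialOrder R)
isPartialOrder? R =
  FinP.all? (λ i → ≼? R i i) ×-dec
  FinP.all? (λ i → FinP.all? λ j → ≼? R i j →-dec ≼? R j i →-dec (i FinP.≟ j)) ×-dec
  FinP.all? (λ i → FinP.all? λ j → FinP.all? λ k →
     ≼? R i j →-dec ≼? R j k →-dec ≼? R i k)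

naturallyLabelled? : ∀ {n} (R : Rel n) → Dec (NaturallyLabelled R)
naturallyLabelled? R =
  FinP.all? λ i → FinP.all? λ j → ≺? R i j →-dec (suc (toℕ i) ℕ.≤? toℕ j)

threeFree? : ∀ {n} (R : Rel n) → Dec (ThreeFree R)
threeFree? R =
  FinP.all? λ i → FinP.all? λ j → FinP.all? λ k →
    ≺? R i j →-dec ≺? R j k →-dec no (λ ())

minimal? : ∀ {n} (R : Rel n) x → Dec (Minimal R x)
minimal? R x = FinP.all? λ y → ¬? (≺? R y x)

Good : ∀ {n} → Rel n → Set
Good R = IsPartialOrder R × NaturallyLabelled R × ThreeFree R

good? : ∀ {n} (R : Rel n) → Dec (Good R)
good? R = isPartialOrder? R ×-dec naturallyLabelled? R ×-dec threeFree? R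

allFinList : (n : ℕ) → List (Fin n)
allFinList n = allFin n

vecsOf : ∀ {A : Set} → List A → (m : ℕ) → List (Vec A m)
vecsOf xs zero    = [] ∷ []
vecsOf xs (suc m) = concatMap (λ x → map (x ∷_) (vecsOf xs m)) xs

allRels : (n : ℕ) → List (Rel n)
allRels n = vecsOf (vecsOf (true ∷ false ∷ []) n) n

numMinimal : ∀ {n} → Rel n → ℕ
numMinimal {n} R = length (filter (minimal? R) (allFinList n))

p : ℕ → ℕ → ℕ
p n k = length (filter (λ R → good? R ×-dec (numMinimal R ℕ.≟ k)) (allRels n))

qint : ℕ → ℕ → ℕ
qint q zero    = 0
qint q (suc k) = qint q k ℕ.+ q ^ k

Sq : ℕ → ℕ → ℕ → ℕ
Sq q zero    zero    = 1
Sq q zero    (suc k) = 0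
Sq q (suc n) zero    = 0
Sq q (suc n) (suc k) = Sq q n k ℕ.+ qint q (suc k) ℕ.* Sq q n (suc k)

sumTo : ℕ → (ℕ → ℤ) → ℤ
sumTo zero    f = f 0
sumTo (suc n) f = sumTo n f ℤ.+ f (suc n)

PS1 : Set
PS1 = ℕ → ℤ

_·₁_ : PS1 → PS1 → PS1
(f ·₁ g) n = sumTo n (λ a → f a ℤ.* g (n ∸ a))

one₁ : PS1
one₁ zero    = 1ℤ
one₁ (suc n) = 0ℤ

-- 1/(1 - a z) = Σ_m a^m z^m
invOneMinus : ℤ → PS1
invOneMinus a m = a ℤ.^ m

prodInv : ℕ → PS1
prodInv zero    = one₁
prodInv (suc k) = prodInv k ·₁ invOneMinus (+ (2 ^ suc k) ℤ.- 1ℤ)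

-- bivariate series in z, y: f n m = coefficient of z^n y^m
PS2 : Set
PS2 = ℕ → ℕ → ℤ

_+₂_ : PS2 → PS2 → PS2
(f +₂ g) n m = f n m ℤ.+ g n m

_-₂_ : PS2 → PS2 → PS2
(f -₂ g) n m = f n m ℤ.- g n m

_·₂_ : PS2 → PS2 → PS2
(f ·₂ g) n m = sumTo n (λ a → sumTo m (λ b → f a b ℤ.* g (n ∸ a) (m ∸ b)))

mono : ℕ → ℕ → PS2
mono a b n m = if (n ≡ᵇ a) ∧ (m ≡ᵇ b) then 1ℤ else 0ℤ

one₂ z y : PS2
one₂ = mono 0 0
z    = mono 1 0
y    = mono 0 1

-- substitution y ↦ c·y :  f(z, c y)
substY : ℤ → PS2 → PS2
substY c f n m = c ℤ.^ m ℤ.* f n m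

embZ : PS1 → PS2
embZ h n zero    = h n
embZ h n (suc m) = 0ℤ

-- sum of a family T of bivariate series where T k has total order ≥ k
-- (so only k ≤ n + m contribute to the coefficient of z^n y^m)
sumFamily : (ℕ → PS2) → PS2
sumFamily T n m = sumTo (n ℕ.+ m) (λ k → T k n m)

F : PS2
F n k = + p n k

G : PS2
G = sumFamily (λ k → mono k k ·₂ embZ (prodInv k))

{-# OPTIONS --safe #-}
-- In a naturally labelled poset on [n+1] the largest label is a maximal element, and deleting it
-- leaves a naturally labelled poset A on [n]; the poset is recovered from A and the strict
-- down-set D of the deleted element. Being 3-free forces D to consist of minimal elements of A,
-- and every such D gives a 3-free poset again. If A has j minimal elements, D = ∅ yields j + 1
-- minimal elements and each of the 2^j − 1 non-empty choices yields j: this is the recurrence,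
-- which is also that of S₂[n,k] since [k]₂ = 2^k − 1. Both generating function identities are
-- coefficientwise restatements of the recurrence; for the product formula note that along the
-- diagonal n = k + j it is the convolution recurrence of the coefficients of
-- Π_{i≤k} 1/(1 − (2^i − 1) z).
module Submission where

open import Defs
open import Data.Nat using (ℕ; zero; suc; _+_; _*_; _∸_; _^_; _<_; _≤_; z≤n; s≤s)
open import Data.Product using (_×_; _,_; proj₁; proj₂)
open import Relation.Binary.PropositionalEquality
  using (_≡_; refl; sym; trans; cong; cong₂; subst₂; _≢_; module ≡-Reasoning)
open import Data.Integer as ℤ using (ℤ; +_; 0ℤ; 1ℤ)
import Data.Integer.Properties as ℤP
open import Data.Integer.Tactic.RingSolver renaming (solve-∀ to solveℤ-∀)
open import Data.Sum using (_⊎_; inj₁; inj₂)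
import Data.Nat.Properties as ℕP
open import Data.Nat.Tactic.RingSolver using (solve-∀)
open import Data.Bool using (Bool; true; false; if_then_else_; _∧_)
import Data.Bool.Properties as BoolP
open import Data.Fin using (Fin; toℕ; inject₁; fromℕ)
import Data.Fin.Properties as FinP
open import Data.Vec using (Vec; []; _∷_; lookup; _∷ʳ_; zipWith; replicate)
import Data.Vec.Properties as VecP
open import Data.List using (List; []; _∷_; _++_; map; concatMap; filter; length; allFin)
import Data.List.Properties as ListP
open import Data.Empty using (⊥-elim)
open import Relation.Nullary using (Dec; yes; no; does; ¬_)
open import Relation.Nullary.Decidable using (_×-dec_; _→-dec_)
open import Relation.Unary using (Pred; Decidable)
open import Function using (_∘_; id)
open import Level using (0ℓ)

𝟙 : {P : Set} → Dec P → ℕ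
𝟙 d = if does d then 1 else 0

𝟙-yes : {P : Set} (d : Dec P) → P → 𝟙 d ≡ 1
𝟙-yes (yes _) _  = refl
𝟙-yes (no ¬p) p = ⊥-elim (¬p p)

𝟙-no : {P : Set} (d : Dec P) → ¬ P → 𝟙 d ≡ 0
𝟙-no (yes p) ¬p = ⊥-elim (¬p p)
𝟙-no (no _)  _  = refl

𝟙-cong : {P Q : Set} (d : Dec P) (e : Dec Q) → (P → Q) → (Q → P) → 𝟙 d ≡ 𝟙 e
𝟙-cong (yes p) e to _    = sym (𝟙-yes e (to p))
𝟙-cong (no ¬p) e _  from = sym (𝟙-no e (¬p ∘ from))

𝟙-× : {P Q : Set} (d : Dec P) (e : Dec Q) → 𝟙 (d ×-dec e) ≡ 𝟙 d * 𝟙 e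
𝟙-× (yes _) (yes _) = refl
𝟙-× (yes _) (no _)  = refl
𝟙-× (no _)  _       = refl

∑ : {A : Set} → List A → (A → ℕ) → ℕ
∑ []       f = 0
∑ (x ∷ xs) f = f x + ∑ xs f

length-filter≡∑𝟙 : {A : Set} {P : Pred A 0ℓ} (P? : Decidable P) (xs : List A) →
                   length (filter P? xs) ≡ ∑ xs (𝟙 ∘ P?)
length-filter≡∑𝟙 P? []       = refl
length-filter≡∑𝟙 P? (x ∷ xs) with P? x
... | yes _ = cong suc (length-filter≡∑𝟙 P? xs)
... | no _  = length-filter≡∑𝟙 P? xs

∑-cong : {A : Set} (xs : List A) {f g : A → ℕ} → (∀ x → f x ≡ g x) → ∑ xs f ≡ ∑ xs g
∑-cong []       f≗g = refl
∑-cong (x ∷ xs) f≗g = cong₂ _+_ (f≗g x) (∑-cong xs f≗g)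

∑-zero : {A : Set} (xs : List A) {f : A → ℕ} → (∀ x → f x ≡ 0) → ∑ xs f ≡ 0
∑-zero xs f≗0 = trans (∑-cong xs f≗0) (∑-const0 xs)
  where
  ∑-const0 : ∀ xs → ∑ xs (λ _ → 0) ≡ 0
  ∑-const0 []       = refl
  ∑-const0 (_ ∷ xs) = ∑-const0 xs

∑-++ : {A : Set} (xs ys : List A) (f : A → ℕ) → ∑ (xs ++ ys) f ≡ ∑ xs f + ∑ ys f
∑-++ []       ys f = refl
∑-++ (x ∷ xs) ys f =
  trans (cong (_+_ (f x)) (∑-++ xs ys f)) (sym (ℕP.+-assoc (f x) (∑ xs f) (∑ ys f)))

∑-+ : {A : Set} (xs : List A) (f g : A → ℕ) → ∑ xs (λ x → f x + g x) ≡ ∑ xs f + ∑ xs g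
∑-+ []       f g = refl
∑-+ (x ∷ xs) f g = trans (cong (_+_ (f x + g x)) (∑-+ xs f g)) (interchange (f x) (g x) _ _)
  where
  interchange : ∀ a b c d → (a + b) + (c + d) ≡ (a + c) + (b + d)
  interchange = solve-∀

∑-*ˡ : {A : Set} (xs : List A) (c : ℕ) (f : A → ℕ) → ∑ xs (λ x → c * f x) ≡ c * ∑ xs f
∑-*ˡ []       c f = sym (ℕP.*-zeroʳ c)
∑-*ˡ (x ∷ xs) c f =
  trans (cong (_+_ (c * f x)) (∑-*ˡ xs c f)) (sym (ℕP.*-distribˡ-+ c (f x) (∑ xs f)))

∑-map : {A B : Set} (h : A → B) (xs : List A) (f : B → ℕ) → ∑ (map h xs) f ≡ ∑ xs (f ∘ h)
∑-map h []       f = refl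
∑-map h (x ∷ xs) f = cong (_+_ (f (h x))) (∑-map h xs f)

∑-concatMap : {A B : Set} (g : A → List B) (xs : List A) (f : B → ℕ) →
              ∑ (concatMap g xs) f ≡ ∑ xs (λ x → ∑ (g x) f)
∑-concatMap g []       f = refl
∑-concatMap g (x ∷ xs) f =
  trans (∑-++ (g x) (concatMap g xs) f) (cong (_+_ (∑ (g x) f)) (∑-concatMap g xs f))

∑-comm : {A B : Set} (xs : List A) (ys : List B) (f : A → B → ℕ) →
         ∑ xs (λ x → ∑ ys (f x)) ≡ ∑ ys (λ y → ∑ xs (λ x → f x y))
∑-comm []       ys f = sym (∑-zero ys (λ _ → refl))
∑-comm (x ∷ xs) ys f =
  trans (cong (_+_ (∑ ys (f x))) (∑-comm xs ys f)) (sym (∑-+ ys (f x) _))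

∑-allFin-suc : ∀ n (f : Fin (suc n) → ℕ) →
               ∑ (allFin (suc n)) f ≡ f Fin.zero + ∑ (allFin n) (f ∘ Fin.suc)
∑-allFin-suc n f =
  cong (_+_ (f Fin.zero)) (trans (cong (λ xs → ∑ xs f) (sym (ListP.map-tabulate id Fin.suc)))
                              (∑-map Fin.suc (allFin n) f))

∑-allFin-∷ʳ : ∀ n (f : Fin (suc n) → ℕ) →
              ∑ (allFin (suc n)) f ≡ ∑ (allFin n) (f ∘ inject₁) + f (fromℕ n)
∑-allFin-∷ʳ zero    f = ℕP.+-identityʳ (f Fin.zero)
∑-allFin-∷ʳ (suc n) f = begin
  ∑ (allFin (suc (suc n))) f
    ≡⟨ ∑-allFin-suc (suc n) f ⟩
  f Fin.zero + ∑ (allFin (suc n)) (f ∘ Fin.suc)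
    ≡⟨ cong (_+_ (f Fin.zero)) (∑-allFin-∷ʳ n (f ∘ Fin.suc)) ⟩
  f Fin.zero + (∑ (allFin n) (f ∘ Fin.suc ∘ inject₁) + f (fromℕ (suc n)))
    ≡⟨ sym (ℕP.+-assoc (f Fin.zero) _ _) ⟩
  f Fin.zero + ∑ (allFin n) (f ∘ inject₁ ∘ Fin.suc) + f (fromℕ (suc n))
    ≡⟨ cong (_+ f (fromℕ (suc n))) (sym (∑-allFin-suc n (f ∘ inject₁))) ⟩
  ∑ (allFin (suc n)) (f ∘ inject₁) + f (fromℕ (suc n))
    ∎
  where open ≡-Reasoning

∑-vecsOf-∷ : {A : Set} (xs : List A) (m : ℕ) (f : Vec A (suc m) → ℕ) →
             ∑ (vecsOf xs (suc m)) f ≡ ∑ xs (λ x → ∑ (vecsOf xs m) (f ∘ (x ∷_)))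
∑-vecsOf-∷ xs m f =
  trans (∑-concatMap _ xs f) (∑-cong xs (λ x → ∑-map (x ∷_) (vecsOf xs m) f))

∑-vecsOf-∷ʳ : {A : Set} (xs : List A) (m : ℕ) (f : Vec A (suc m) → ℕ) →
              ∑ (vecsOf xs (suc m)) f ≡ ∑ (vecsOf xs m) (λ v → ∑ xs (λ x → f (v ∷ʳ x)))
∑-vecsOf-∷ʳ xs zero    f = trans (∑-vecsOf-∷ xs zero f) (
  trans (∑-cong xs (λ x → ℕP.+-identityʳ (f (x ∷ [])))) (sym (ℕP.+-identityʳ _)))
∑-vecsOf-∷ʳ xs (suc m) f = begin
  ∑ (vecsOf xs (suc (suc m))) f
    ≡⟨ ∑-vecsOf-∷ xs (suc m) f ⟩
  ∑ xs (λ x → ∑ (vecsOf xs (suc m)) (f ∘ (x ∷_)))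
    ≡⟨ ∑-cong xs (λ x → ∑-vecsOf-∷ʳ xs m (f ∘ (x ∷_))) ⟩
  ∑ xs (λ x → ∑ (vecsOf xs m) (λ v → ∑ xs (λ y → f (x ∷ (v ∷ʳ y)))))
    ≡⟨ sym (∑-vecsOf-∷ xs m _) ⟩
  ∑ (vecsOf xs (suc m)) (λ v → ∑ xs (λ y → f (v ∷ʳ y)))
    ∎
  where open ≡-Reasoning

∑-vecsOf-zipWith-∷ʳ : {A : Set} (xs : List A) (m n : ℕ) (f : Vec (Vec A (suc m)) n → ℕ) →
                      ∑ (vecsOf (vecsOf xs (suc m)) n) f ≡
                      ∑ (vecsOf (vecsOf xs m) n) (λ M →
                        ∑ (vecsOf xs n) (λ c → f (zipWith _∷ʳ_ M c)))
∑-vecsOf-zipWith-∷ʳ xs m zero    f = sym (ℕP.+-identityʳ _)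
∑-vecsOf-zipWith-∷ʳ xs m (suc n) f = begin
  ∑ (vecsOf (vecsOf xs (suc m)) (suc n)) f
    ≡⟨ ∑-vecsOf-∷ (vecsOf xs (suc m)) n f ⟩
  ∑ (vecsOf xs (suc m)) (λ u → ∑ (vecsOf (vecsOf xs (suc m)) n) (f ∘ (u ∷_)))
    ≡⟨ ∑-vecsOf-∷ʳ xs m _ ⟩
  ∑ (vecsOf xs m) (λ w → ∑ xs (λ x → ∑ (vecsOf (vecsOf xs (suc m)) n) (f ∘ ((w ∷ʳ x) ∷_))))
    ≡⟨ ∑-cong (vecsOf xs m) (λ w → ∑-cong xs (λ x →
         ∑-vecsOf-zipWith-∷ʳ xs m n (f ∘ ((w ∷ʳ x) ∷_)))) ⟩
  ∑ (vecsOf xs m) (λ w → ∑ xs (λ x → ∑ (vecsOf (vecsOf xs m) n) (λ M → ∑ (vecsOf xs n) (λ c →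
      f ((w ∷ʳ x) ∷ zipWith _∷ʳ_ M c)))))
    ≡⟨ ∑-cong (vecsOf xs m) (λ w → ∑-comm xs (vecsOf (vecsOf xs m) n) _) ⟩
  ∑ (vecsOf xs m) (λ w → ∑ (vecsOf (vecsOf xs m) n) (λ M → ∑ xs (λ x → ∑ (vecsOf xs n) (λ c →
      f (zipWith _∷ʳ_ (w ∷ M) (x ∷ c))))))
    ≡⟨ sym (∑-vecsOf-∷ (vecsOf xs m) n _) ⟩
  ∑ (vecsOf (vecsOf xs m) (suc n)) (λ M → ∑ xs (λ x → ∑ (vecsOf xs n) (λ c →
      f (zipWith _∷ʳ_ M (x ∷ c)))))
    ≡⟨ ∑-cong (vecsOf (vecsOf xs m) (suc n)) (λ M → sym (∑-vecsOf-∷ xs n _)) ⟩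
  ∑ (vecsOf (vecsOf xs m) (suc n)) (λ M → ∑ (vecsOf xs (suc n)) (λ c → f (zipWith _∷ʳ_ M c)))
    ∎
  where open ≡-Reasoning

true≢false : true ≢ false
true≢false ()

-- A Boolean vector c : Vec Bool n stands for the subset {i ∣ lookup c i ≡ true} of Fin n.
subsets : (n : ℕ) → List (Vec Bool n)
subsets = vecsOf (true ∷ false ∷ [])

_⊆_ : ∀ {n} → Vec Bool n → Pred (Fin n) 0ℓ → Set
c ⊆ M = ∀ i → lookup c i ≡ true → M i

_⊆?_ : ∀ {n} {M : Pred (Fin n) 0ℓ} (c : Vec Bool n) → Decidable M → Dec (c ⊆ M)
c ⊆? M? = FinP.all? (λ i → (lookup c i BoolP.≟ true) →-dec M? i)

IsEmpty : ∀ {n} → Vec Bool n → Set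
IsEmpty c = ∀ i → lookup c i ≡ false

isEmpty? : ∀ {n} (c : Vec Bool n) → Dec (IsEmpty c)
isEmpty? c = FinP.all? (λ i → lookup c i BoolP.≟ false)

∑-subsets-replicate : ∀ n (g : Vec Bool n → ℕ) → (∀ c i → lookup c i ≡ true → g c ≡ 0) →
                      ∑ (subsets n) g ≡ g (replicate n false)
∑-subsets-replicate zero    g _     = ℕP.+-identityʳ (g [])
∑-subsets-replicate (suc n) g g≡0 = begin
  ∑ (subsets (suc n)) g
    ≡⟨ ∑-vecsOf-∷ _ n g ⟩
  ∑ (subsets n) (g ∘ (true ∷_)) + (∑ (subsets n) (g ∘ (false ∷_)) + 0)
    ≡⟨ cong₂ _+_ (∑-zero (subsets n) (λ c → g≡0 (true ∷ c) Fin.zero refl)) (ℕP.+-identityʳ _) ⟩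
  ∑ (subsets n) (g ∘ (false ∷_))
    ≡⟨ ∑-subsets-replicate n (g ∘ (false ∷_)) (λ c i → g≡0 (false ∷ c) (Fin.suc i)) ⟩
  g (replicate (suc n) false)
    ∎
  where open ≡-Reasoning

module _ {n : ℕ} {M : Pred (Fin (suc n)) 0ℓ} (M? : Decidable M) (c : Vec Bool n) where

  𝟙-false∷⊆ : 𝟙 ((false ∷ c) ⊆? M?) ≡ 𝟙 (c ⊆? (M? ∘ Fin.suc))
  𝟙-false∷⊆ = 𝟙-cong ((false ∷ c) ⊆? M?) (c ⊆? (M? ∘ Fin.suc)) (λ c⊆M i → c⊆M (Fin.suc i)) from
    where
    from : c ⊆ (M ∘ Fin.suc) → (false ∷ c) ⊆ M
    from c⊆M Fin.zero    ()
    from c⊆M (Fin.suc i) = c⊆M i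

  𝟙-true∷⊆ : 𝟙 ((true ∷ c) ⊆? M?) ≡ 𝟙 (M? Fin.zero) * 𝟙 (c ⊆? (M? ∘ Fin.suc))
  𝟙-true∷⊆ = trans (𝟙-cong ((true ∷ c) ⊆? M?) (M? Fin.zero ×-dec c ⊆? (M? ∘ Fin.suc))
                           (λ c⊆M → c⊆M Fin.zero refl , λ i → c⊆M (Fin.suc i)) from)
                   (𝟙-× (M? Fin.zero) (c ⊆? (M? ∘ Fin.suc)))
    where
    from : M Fin.zero × c ⊆ (M ∘ Fin.suc) → (true ∷ c) ⊆ M
    from (m , _)   Fin.zero    _ = m
    from (_ , c⊆M) (Fin.suc i) = c⊆M i

2^[𝟙+n] : {P : Set} (d : Dec P) (n : ℕ) → 2 ^ (𝟙 d + n) ≡ 𝟙 d * 2 ^ n + 2 ^ n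
2^[𝟙+n] (yes _) n = double (2 ^ n)
  where
  double : ∀ x → 2 * x ≡ 1 * x + x
  double = solve-∀
2^[𝟙+n] (no _)  n = refl

∑-subsets-⊆ : ∀ n {M : Pred (Fin n) 0ℓ} (M? : Decidable M) →
              ∑ (subsets n) (λ c → 𝟙 (c ⊆? M?)) ≡ 2 ^ ∑ (allFin n) (𝟙 ∘ M?)
∑-subsets-⊆ zero    M? = refl
∑-subsets-⊆ (suc n) M? = begin
  ∑ (subsets (suc n)) (λ c → 𝟙 (c ⊆? M?))
    ≡⟨ ∑-vecsOf-∷ _ n _ ⟩
  ∑ (subsets n) (λ c → 𝟙 ((true ∷ c) ⊆? M?)) + (∑ (subsets n) (λ c → 𝟙 ((false ∷ c) ⊆? M?)) + 0)
    ≡⟨ cong₂ _+_ (trans (∑-cong (subsets n) (𝟙-true∷⊆ M?)) (∑-*ˡ (subsets n) (𝟙 (M? Fin.zero)) _))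
                 (trans (ℕP.+-identityʳ _) (∑-cong (subsets n) (𝟙-false∷⊆ M?))) ⟩
  𝟙 (M? Fin.zero) * ∑ (subsets n) (λ c → 𝟙 (c ⊆? M?′)) + ∑ (subsets n) (λ c → 𝟙 (c ⊆? M?′))
    ≡⟨ cong (λ s → 𝟙 (M? Fin.zero) * s + s) (∑-subsets-⊆ n M?′) ⟩
  𝟙 (M? Fin.zero) * 2 ^ ∑ (allFin n) (𝟙 ∘ M?′) + 2 ^ ∑ (allFin n) (𝟙 ∘ M?′)
    ≡⟨ sym (2^[𝟙+n] (M? Fin.zero) _) ⟩
  2 ^ (𝟙 (M? Fin.zero) + ∑ (allFin n) (𝟙 ∘ M?′))
    ≡⟨ cong (2 ^_) (sym (∑-allFin-suc n (𝟙 ∘ M?))) ⟩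
  2 ^ ∑ (allFin (suc n)) (𝟙 ∘ M?)
    ∎
  where
  open ≡-Reasoning
  M?′ = M? ∘ Fin.suc

∑-subsets-⊆∩IsEmpty : ∀ n {M : Pred (Fin n) 0ℓ} (M? : Decidable M) →
                      ∑ (subsets n) (λ c → 𝟙 (c ⊆? M?) * 𝟙 (isEmpty? c)) ≡ 1
∑-subsets-⊆∩IsEmpty n M? = trans (∑-subsets-replicate n _ nonempty) (cong₂ _*_ ∅⊆M ∅-empty)
  where
  nonempty : ∀ c i → lookup c i ≡ true → 𝟙 (c ⊆? M?) * 𝟙 (isEmpty? c) ≡ 0
  nonempty c i ci≡true =
    trans (cong (_*_ (𝟙 (c ⊆? M?)))
                (𝟙-no (isEmpty? c) (λ empty → true≢false (trans (sym ci≡true) (empty i)))))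
          (ℕP.*-zeroʳ (𝟙 (c ⊆? M?)))
  ∅⊆M : 𝟙 (replicate n false ⊆? M?) ≡ 1
  ∅⊆M = 𝟙-yes (replicate n false ⊆? M?)
              (λ i eq → ⊥-elim (true≢false (trans (sym eq) (VecP.lookup-replicate i false))))
  ∅-empty : 𝟙 (isEmpty? (replicate n false)) ≡ 1
  ∅-empty = 𝟙-yes (isEmpty? (replicate n false)) (λ i → VecP.lookup-replicate i false)

m+n≡o+n*2^j⇒m≡o+n*[2^j∸1] : ∀ m n o j → m + n ≡ o + n * 2 ^ j → m ≡ o + n * (2 ^ j ∸ 1)
m+n≡o+n*2^j⇒m≡o+n*[2^j∸1] m n o j eq = ℕP.+-cancelʳ-≡ n m (o + n * (2 ^ j ∸ 1)) (begin
  m + n                    ≡⟨ eq ⟩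
  o + n * 2 ^ j            ≡⟨ cong (λ t → o + n * t) (sym (ℕP.m∸n+n≡m (ℕP.m^n>0 2 j))) ⟩
  o + n * (2 ^ j ∸ 1 + 1)  ≡⟨ distrib o n (2 ^ j ∸ 1) ⟩
  o + n * (2 ^ j ∸ 1) + n  ∎)
  where
  open ≡-Reasoning
  distrib : ∀ o n x → o + n * (x + 1) ≡ o + n * x + n
  distrib = solve-∀

-- The number of good one-point extensions with k minimal elements of a good poset with j of them.
extensions : ℕ → ℕ → ℕ
extensions j k = 𝟙 (suc j ℕP.≟ k) + 𝟙 (j ℕP.≟ k) * (2 ^ j ∸ 1)

-- Adding 𝟙 (j ≟ k) times the single empty subset to both sides avoids the truncated subtraction.
∑-subsets-⊆-count : ∀ n {M : Pred (Fin n) 0ℓ} (M? : Decidable M) k → let j = ∑ (allFin n) (𝟙 ∘ M?) in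
  ∑ (subsets n) (λ c → 𝟙 (c ⊆? M?) * 𝟙 (j + 𝟙 (isEmpty? c) ℕP.≟ k)) ≡ extensions j k
∑-subsets-⊆-count n M? k = m+n≡o+n*2^j⇒m≡o+n*[2^j∸1] _ Y X j (begin
  ∑ (subsets n) (λ c → ⊆c c * 𝟙 (j + ∅c c ℕP.≟ k)) + Y
    ≡⟨ cong (_+_ _) (sym (trans (cong (_*_ Y) (∑-subsets-⊆∩IsEmpty n M?)) (ℕP.*-identityʳ Y))) ⟩
  ∑ (subsets n) (λ c → ⊆c c * 𝟙 (j + ∅c c ℕP.≟ k)) + Y * ∑ (subsets n) (λ c → ⊆c c * ∅c c)
    ≡⟨ cong (_+_ _) (sym (∑-*ˡ (subsets n) Y _)) ⟩
  ∑ (subsets n) (λ c → ⊆c c * 𝟙 (j + ∅c c ℕP.≟ k)) + ∑ (subsets n) (λ c → Y * (⊆c c * ∅c c))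
    ≡⟨ sym (∑-+ (subsets n) _ _) ⟩
  ∑ (subsets n) (λ c → ⊆c c * 𝟙 (j + ∅c c ℕP.≟ k) + Y * (⊆c c * ∅c c))
    ≡⟨ ∑-cong (subsets n) (λ c → pointwise (⊆c c) (isEmpty? c)) ⟩
  ∑ (subsets n) (λ c → X * (⊆c c * ∅c c) + Y * ⊆c c)
    ≡⟨ ∑-+ (subsets n) _ _ ⟩
  ∑ (subsets n) (λ c → X * (⊆c c * ∅c c)) + ∑ (subsets n) (λ c → Y * ⊆c c)
    ≡⟨ cong₂ _+_ (∑-*ˡ (subsets n) X _) (∑-*ˡ (subsets n) Y _) ⟩
  X * ∑ (subsets n) (λ c → ⊆c c * ∅c c) + Y * ∑ (subsets n) ⊆c
    ≡⟨ cong₂ _+_ (trans (cong (_*_ X) (∑-subsets-⊆∩IsEmpty n M?)) (ℕP.*-identityʳ X))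
                 (cong (_*_ Y) (∑-subsets-⊆ n M?)) ⟩
  X + Y * 2 ^ j
    ∎)
  where
  open ≡-Reasoning
  j  = ∑ (allFin n) (𝟙 ∘ M?)
  X  = 𝟙 (suc j ℕP.≟ k)
  Y  = 𝟙 (j ℕP.≟ k)
  ⊆c = λ c → 𝟙 (c ⊆? M?)
  ∅c = λ c → 𝟙 (isEmpty? c)
  pointwise : ∀ s {P : Set} (e : Dec P) →
              s * 𝟙 (j + 𝟙 e ℕP.≟ k) + Y * (s * 𝟙 e) ≡ X * (s * 𝟙 e) + Y * s
  pointwise s (yes _) rewrite ℕP.+-comm j 1 = comm s X Y
    where
    comm : ∀ s X Y → s * X + Y * (s * 1) ≡ X * (s * 1) + Y * s
    comm = solve-∀
  pointwise s (no _) rewrite ℕP.+-identityʳ j = comm s X Y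
    where
    comm : ∀ s X Y → s * Y + Y * (s * 0) ≡ X * (s * 0) + Y * s
    comm = solve-∀

-- extend A c r b adjoins a new largest label to A, with column c (i ≼ new), row r (new ≼ j)
-- and diagonal entry b.
extend : ∀ {n} → Rel n → Vec Bool n → Vec Bool n → Bool → Rel (suc n)
extend A c r b = zipWith _∷ʳ_ A c ∷ʳ (r ∷ʳ b)

∑-allRels-suc : ∀ n (f : Rel (suc n) → ℕ) →
  ∑ (allRels (suc n)) f ≡
  ∑ (allRels n) (λ A → ∑ (subsets n) (λ c → ∑ (subsets n) (λ r → ∑ (true ∷ false ∷ []) (λ b →
    f (extend A c r b)))))
∑-allRels-suc n f = begin
  ∑ (allRels (suc n)) f
    ≡⟨ ∑-vecsOf-∷ʳ (subsets (suc n)) n f ⟩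
  ∑ (vecsOf (subsets (suc n)) n) (λ M → ∑ (subsets (suc n)) (λ row → f (M ∷ʳ row)))
    ≡⟨ ∑-vecsOf-zipWith-∷ʳ _ n n _ ⟩
  ∑ (allRels n) (λ A → ∑ (subsets n) (λ c → ∑ (subsets (suc n)) (λ row →
    f (zipWith _∷ʳ_ A c ∷ʳ row))))
    ≡⟨ ∑-cong (allRels n) (λ A → ∑-cong (subsets n) (λ c → ∑-vecsOf-∷ʳ _ n _)) ⟩
  ∑ (allRels n) (λ A → ∑ (subsets n) (λ c → ∑ (subsets n) (λ r → ∑ (true ∷ false ∷ []) (λ b →
    f (extend A c r b)))))
    ∎
  where open ≡-Reasoning

data InjectOrLast {n : ℕ} : Fin (suc n) → Set where
  inj  : (i : Fin n) → InjectOrLast (inject₁ i)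
  last : InjectOrLast (fromℕ n)

injectOrLast : ∀ {n} (x : Fin (suc n)) → InjectOrLast x
injectOrLast {zero}  Fin.zero    = last
injectOrLast {suc n} Fin.zero    = inj Fin.zero
injectOrLast {suc n} (Fin.suc x) with injectOrLast x
... | inj i = inj (Fin.suc i)
... | last  = last

lookup-∷ʳ-inject₁ : {A : Set} {n : ℕ} (xs : Vec A n) (x : A) (i : Fin n) →
                    lookup (xs ∷ʳ x) (inject₁ i) ≡ lookup xs i
lookup-∷ʳ-inject₁ (y ∷ xs) x Fin.zero    = refl
lookup-∷ʳ-inject₁ (y ∷ xs) x (Fin.suc i) = lookup-∷ʳ-inject₁ xs x i

lookup-∷ʳ-fromℕ : {A : Set} {n : ℕ} (xs : Vec A n) (x : A) → lookup (xs ∷ʳ x) (fromℕ n) ≡ x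
lookup-∷ʳ-fromℕ []       x = refl
lookup-∷ʳ-fromℕ (y ∷ xs) x = lookup-∷ʳ-fromℕ xs x

inject₁≢fromℕ : ∀ {n} (i : Fin n) → inject₁ i ≢ fromℕ n
inject₁≢fromℕ i = FinP.fromℕ≢inject₁ ∘ sym

module Extend {n : ℕ} (A : Rel n) (c r : Vec Bool n) (b : Bool) where

  private
    E = extend A c r b

  private
    row-inject₁ : ∀ i → lookup E (inject₁ i) ≡ lookup A i ∷ʳ lookup c i
    row-inject₁ i =
      trans (lookup-∷ʳ-inject₁ (zipWith _∷ʳ_ A c) (r ∷ʳ b) i) (VecP.lookup-zipWith _∷ʳ_ i A c)

    row-last : lookup E (fromℕ n) ≡ r ∷ʳ b
    row-last = lookup-∷ʳ-fromℕ (zipWith _∷ʳ_ A c) (r ∷ʳ b)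

  lookup-extend-inject₁ : ∀ i j → lookup (lookup E (inject₁ i)) (inject₁ j) ≡ lookup (lookup A i) j
  lookup-extend-inject₁ i j =
    trans (cong (λ row → lookup row (inject₁ j)) (row-inject₁ i))
          (lookup-∷ʳ-inject₁ (lookup A i) (lookup c i) j)

  lookup-extend-column : ∀ i → lookup (lookup E (inject₁ i)) (fromℕ n) ≡ lookup c i
  lookup-extend-column i =
    trans (cong (λ row → lookup row (fromℕ n)) (row-inject₁ i))
          (lookup-∷ʳ-fromℕ (lookup A i) (lookup c i))

  lookup-extend-row : ∀ j → lookup (lookup E (fromℕ n)) (inject₁ j) ≡ lookup r j
  lookup-extend-row j =
    trans (cong (λ row → lookup row (inject₁ j)) row-last) (lookup-∷ʳ-inject₁ r b j)

  lookup-extend-corner : lookup (lookup E (fromℕ n)) (fromℕ n) ≡ b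
  lookup-extend-corner = trans (cong (λ row → lookup row (fromℕ n)) row-last) (lookup-∷ʳ-fromℕ r b)

  ≼-restrict : ∀ {i j} → E ⊢ inject₁ i ≼ inject₁ j → A ⊢ i ≼ j
  ≼-restrict {i} {j} = trans (sym (lookup-extend-inject₁ i j))

  ≼-embed : ∀ {i j} → A ⊢ i ≼ j → E ⊢ inject₁ i ≼ inject₁ j
  ≼-embed {i} {j} = trans (lookup-extend-inject₁ i j)

  ≺-restrict : ∀ {i j} → E ⊢ inject₁ i ≺ inject₁ j → A ⊢ i ≺ j
  ≺-restrict (i≼j , i≢j) = ≼-restrict i≼j , i≢j ∘ cong inject₁

  ≺-embed : ∀ {i j} → A ⊢ i ≺ j → E ⊢ inject₁ i ≺ inject₁ j
  ≺-embed (i≼j , i≢j) = ≼-embed i≼j , i≢j ∘ FinP.inject₁-injective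

  ≺-column : ∀ {i} → lookup c i ≡ true → E ⊢ inject₁ i ≺ fromℕ n
  ≺-column {i} ci≡true = trans (lookup-extend-column i) ci≡true , inject₁≢fromℕ i

  Good-extend⇒corner : Good E → b ≡ true
  Good-extend⇒corner ((refl≼ , _) , _) = trans (sym lookup-extend-corner) (refl≼ (fromℕ n))

  -- The new label is the largest, so natural labelling forbids it lying below anything.
  Good-extend⇒row : Good E → ∀ j → lookup r j ≢ true
  Good-extend⇒row (_ , natural , _) j rj≡true = ℕP.<-asym (FinP.toℕ<n j) n<j
    where
    n<j : n < toℕ j
    n<j = subst₂ _<_ (FinP.toℕ-fromℕ n) (FinP.toℕ-inject₁ j)
            (natural (fromℕ n) (inject₁ j)
              (trans (lookup-extend-row j) rj≡true , inject₁≢fromℕ j ∘ sym))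

  Good-extend⇒Good : Good E → Good A
  Good-extend⇒Good ((refl≼ , antisym , trans≼) , natural , free) =
    ((λ i → ≼-restrict (refl≼ (inject₁ i))) ,
     (λ i j i≼j j≼i → FinP.inject₁-injective (antisym _ _ (≼-embed i≼j) (≼-embed j≼i))) ,
     (λ i j k i≼j j≼k → ≼-restrict (trans≼ _ _ _ (≼-embed i≼j) (≼-embed j≼k)))) ,
    (λ i j i≺j → subst₂ _<_ (FinP.toℕ-inject₁ i) (FinP.toℕ-inject₁ j) (natural _ _ (≺-embed i≺j))) ,
    (λ i j k i≺j j≺k → free _ _ _ (≺-embed i≺j) (≺-embed j≺k))

  Good-extend⇒column⊆Minimal : Good E → c ⊆ Minimal A
  Good-extend⇒column⊆Minimal (_ , _ , free) i ci≡true j j≺i =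
    free _ _ _ (≺-embed j≺i) (≺-column ci≡true)

  Minimal-extend⇒Minimal : ∀ i → Minimal E (inject₁ i) → Minimal A i
  Minimal-extend⇒Minimal i minimal j j≺i = minimal (inject₁ j) (≺-embed j≺i)

  Minimal-extend-last⇒IsEmpty : Minimal E (fromℕ n) → IsEmpty c
  Minimal-extend-last⇒IsEmpty minimal i with lookup c i in ci
  ... | true  = ⊥-elim (minimal (inject₁ i) (≺-column ci))
  ... | false = refl

  IsEmpty⇒Minimal-extend-last : IsEmpty c → Minimal E (fromℕ n)
  IsEmpty⇒Minimal-extend-last empty x x≺last with injectOrLast x
  ... | inj i = true≢false (trans (sym (proj₁ x≺last)) (trans (lookup-extend-column i) (empty i)))
  ... | last  = proj₂ x≺last refl

addTop : ∀ {n} → Rel n → Vec Bool n → Rel (suc n)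
addTop {n} A c = extend A c (replicate n false) true

module AddTop {n : ℕ} (A : Rel n) (c : Vec Bool n) where

  open Extend A c (replicate n false) true public

  private
    E = addTop A c

  top⋠inject₁ : ∀ j → ¬ (E ⊢ fromℕ n ≼ inject₁ j)
  top⋠inject₁ j top≼j =
    true≢false (trans (sym top≼j) (trans (lookup-extend-row j) (VecP.lookup-replicate j false)))

  addTop-reflexive : (∀ i → A ⊢ i ≼ i) → ∀ x → E ⊢ x ≼ x
  addTop-reflexive refl≼ x with injectOrLast x
  ... | inj i = ≼-embed (refl≼ i)
  ... | last  = lookup-extend-corner

  addTop-antisym : (∀ i j → A ⊢ i ≼ j → A ⊢ j ≼ i → i ≡ j) →
                   ∀ x y → E ⊢ x ≼ y → E ⊢ y ≼ x → x ≡ y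
  addTop-antisym antisym x y x≼y y≼x with injectOrLast x | injectOrLast y
  ... | inj i | inj j = cong inject₁ (antisym i j (≼-restrict x≼y) (≼-restrict y≼x))
  ... | inj i | last  = ⊥-elim (top⋠inject₁ i y≼x)
  ... | last  | inj j = ⊥-elim (top⋠inject₁ j x≼y)
  ... | last  | last  = refl

  -- Transitivity through the new top needs c to be a down-set of A; a set of minimal elements is.
  addTop-transitive : (∀ i j k → A ⊢ i ≼ j → A ⊢ j ≼ k → A ⊢ i ≼ k) → c ⊆ Minimal A →
                      ∀ x y z → E ⊢ x ≼ y → E ⊢ y ≼ z → E ⊢ x ≼ z
  addTop-transitive trans≼ c⊆Min x y z x≼y y≼z with injectOrLast x | injectOrLast y | injectOrLast z
  ... | inj i | inj j | inj k = ≼-embed (trans≼ i j k (≼-restrict x≼y) (≼-restrict y≼z))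
  ... | inj i | inj j | last with i FinP.≟ j
  ...   | yes refl = y≼z
  ...   | no  i≢j  =
    ⊥-elim (c⊆Min j (trans (sym (lookup-extend-column j)) y≼z) i (≼-restrict x≼y , i≢j))
  addTop-transitive _ _ x y z x≼y y≼z | _     | last  | inj k = ⊥-elim (top⋠inject₁ k y≼z)
  addTop-transitive _ _ x y z x≼y y≼z | _     | last  | last  = x≼y
  addTop-transitive _ _ x y z x≼y y≼z | last  | inj j | _     = ⊥-elim (top⋠inject₁ j x≼y)

  addTop-naturallyLabelled : NaturallyLabelled A → NaturallyLabelled E
  addTop-naturallyLabelled natural x y (x≼y , x≢y) with injectOrLast x | injectOrLast y
  ... | inj i | inj j = subst₂ _<_ (sym (FinP.toℕ-inject₁ i)) (sym (FinP.toℕ-inject₁ j))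
                          (natural i j (≺-restrict (x≼y , x≢y)))
  ... | inj i | last  =
    subst₂ _<_ (sym (FinP.toℕ-inject₁ i)) (sym (FinP.toℕ-fromℕ n)) (FinP.toℕ<n i)
  ... | last  | inj j = ⊥-elim (top⋠inject₁ j x≼y)
  ... | last  | last  = ⊥-elim (x≢y refl)

  addTop-threeFree : ThreeFree A → c ⊆ Minimal A → ThreeFree E
  addTop-threeFree free c⊆Min x y z x≺y y≺z with injectOrLast x | injectOrLast y | injectOrLast z
  ... | _     | last  | inj k = top⋠inject₁ k (proj₁ y≺z)
  ... | _     | last  | last  = proj₂ y≺z refl
  ... | last  | inj j | _     = top⋠inject₁ j (proj₁ x≺y)
  ... | inj i | inj j | inj k = free i j k (≺-restrict x≺y) (≺-restrict y≺z)
  ... | inj i | inj j | last  =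
    c⊆Min j (trans (sym (lookup-extend-column j)) (proj₁ y≺z)) i (≺-restrict x≺y)

  Good⇒Good-addTop : Good A → c ⊆ Minimal A → Good E
  Good⇒Good-addTop ((refl≼ , antisym , trans≼) , natural , free) c⊆Min =
    (addTop-reflexive refl≼ , addTop-antisym antisym , addTop-transitive trans≼ c⊆Min) ,
    addTop-naturallyLabelled natural ,
    addTop-threeFree free c⊆Min

  Minimal⇒Minimal-addTop : ∀ i → Minimal A i → Minimal E (inject₁ i)
  Minimal⇒Minimal-addTop i minimal x x≺i with injectOrLast x
  ... | inj j = minimal j (≺-restrict x≺i)
  ... | last  = top⋠inject₁ i (proj₁ x≺i)

counted : ∀ {n} → ℕ → Rel n → ℕ
counted k R = 𝟙 (good? R) * 𝟙 (numMinimal R ℕP.≟ k)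

p≡∑counted : ∀ n k → p n k ≡ ∑ (allRels n) (counted k)
p≡∑counted n k = trans (length-filter≡∑𝟙 _ (allRels n))
                       (∑-cong (allRels n) (λ R → 𝟙-× (good? R) (numMinimal R ℕP.≟ k)))

numMinimal≡∑ : ∀ {n} (R : Rel n) → numMinimal R ≡ ∑ (allFin n) (𝟙 ∘ minimal? R)
numMinimal≡∑ {n} R = length-filter≡∑𝟙 (minimal? R) (allFin n)

module _ {n : ℕ} (A : Rel n) (c : Vec Bool n) where

  open AddTop A c

  numMinimal-addTop : numMinimal (addTop A c) ≡ numMinimal A + 𝟙 (isEmpty? c)
  numMinimal-addTop = begin
    numMinimal (addTop A c)
      ≡⟨ numMinimal≡∑ (addTop A c) ⟩
    ∑ (allFin (suc n)) (𝟙 ∘ minimal? (addTop A c))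
      ≡⟨ ∑-allFin-∷ʳ n _ ⟩
    ∑ (allFin n) (𝟙 ∘ minimal? (addTop A c) ∘ inject₁) + 𝟙 (minimal? (addTop A c) (fromℕ n))
      ≡⟨ cong₂ _+_
           (∑-cong (allFin n) (λ i → 𝟙-cong (minimal? (addTop A c) (inject₁ i)) (minimal? A i)
                                              (Minimal-extend⇒Minimal i) (Minimal⇒Minimal-addTop i)))
           (𝟙-cong (minimal? (addTop A c) (fromℕ n)) (isEmpty? c)
                   Minimal-extend-last⇒IsEmpty IsEmpty⇒Minimal-extend-last) ⟩
    ∑ (allFin n) (𝟙 ∘ minimal? A) + 𝟙 (isEmpty? c)
      ≡⟨ cong (_+ 𝟙 (isEmpty? c)) (sym (numMinimal≡∑ A)) ⟩
    numMinimal A + 𝟙 (isEmpty? c)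
      ∎
    where open ≡-Reasoning

  𝟙-good-addTop : 𝟙 (good? (addTop A c)) ≡ 𝟙 (good? A) * 𝟙 (c ⊆? minimal? A)
  𝟙-good-addTop =
    trans (𝟙-cong (good? (addTop A c)) (good? A ×-dec c ⊆? minimal? A)
                  (λ good → Good-extend⇒Good good , Good-extend⇒column⊆Minimal good)
                  (λ (good , c⊆Min) → Good⇒Good-addTop good c⊆Min))
          (𝟙-× (good? A) (c ⊆? minimal? A))

  -- A good extension has a true diagonal (reflexivity) and an empty row (natural labelling),
  -- so among those with column c only addTop A c can count.
  ∑-rows-counted : ∀ k →
    ∑ (subsets n) (λ r → ∑ (true ∷ false ∷ []) (λ b → counted k (extend A c r b))) ≡
    𝟙 (good? A) * (𝟙 (c ⊆? minimal? A) * 𝟙 (numMinimal A + 𝟙 (isEmpty? c) ℕP.≟ k))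
  ∑-rows-counted k = begin
    ∑ (subsets n) (λ r → counted k (extend A c r true) + (counted k (extend A c r false) + 0))
      ≡⟨ ∑-cong (subsets n) (λ r → trans (cong (_+_ _) (trans (ℕP.+-identityʳ _) (diagonal-false r)))
                                          (ℕP.+-identityʳ _)) ⟩
    ∑ (subsets n) (λ r → counted k (extend A c r true))
      ≡⟨ ∑-subsets-replicate n _ row-false ⟩
    counted k (addTop A c)
      ≡⟨ cong₂ _*_ 𝟙-good-addTop (cong (λ m → 𝟙 (m ℕP.≟ k)) numMinimal-addTop) ⟩
    𝟙 (good? A) * 𝟙 (c ⊆? minimal? A) * 𝟙 (numMinimal A + 𝟙 (isEmpty? c) ℕP.≟ k)
      ≡⟨ ℕP.*-assoc (𝟙 (good? A)) _ _ ⟩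
    𝟙 (good? A) * (𝟙 (c ⊆? minimal? A) * 𝟙 (numMinimal A + 𝟙 (isEmpty? c) ℕP.≟ k))
      ∎
    where
    open ≡-Reasoning
    not-good⇒not-counted : (R : Rel (suc n)) → ¬ Good R → counted k R ≡ 0
    not-good⇒not-counted R bad = cong (_* 𝟙 (numMinimal R ℕP.≟ k)) (𝟙-no (good? R) bad)
    diagonal-false : ∀ r → counted k (extend A c r false) ≡ 0
    diagonal-false r = not-good⇒not-counted (extend A c r false)
                         (λ good → true≢false (sym (Extend.Good-extend⇒corner A c r false good)))
    row-false : ∀ r j → lookup r j ≡ true → counted k (extend A c r true) ≡ 0
    row-false r j rj≡true = not-good⇒not-counted (extend A c r true)
                              (λ good → Extend.Good-extend⇒row A c r true good j rj≡true)

∑-extensions-counted : ∀ {n} (A : Rel n) k →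
  ∑ (subsets n) (λ c → ∑ (subsets n) (λ r → ∑ (true ∷ false ∷ []) (λ b →
    counted k (extend A c r b)))) ≡
  𝟙 (good? A) * extensions (numMinimal A) k
∑-extensions-counted {n} A k =
  trans (∑-cong (subsets n) (λ c → ∑-rows-counted A c k))
        (trans (∑-*ˡ (subsets n) (𝟙 (good? A)) _) (cong (_*_ (𝟙 (good? A))) count))
  where
  count : ∑ (subsets n) (λ c → 𝟙 (c ⊆? minimal? A) * 𝟙 (numMinimal A + 𝟙 (isEmpty? c) ℕP.≟ k)) ≡
          extensions (numMinimal A) k
  count rewrite numMinimal≡∑ A = ∑-subsets-⊆-count n (minimal? A) k

p-suc : ∀ n k → p (suc n) k ≡ ∑ (allRels n) (λ A → 𝟙 (good? A) * extensions (numMinimal A) k)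
p-suc n k = trans (p≡∑counted (suc n) k)
                  (trans (∑-allRels-suc n (counted k))
                         (∑-cong (allRels n) (λ A → ∑-extensions-counted A k)))

extensions-zero : ∀ j → extensions j 0 ≡ 0
extensions-zero zero    = refl
extensions-zero (suc j) = refl

𝟙*-subst : {A : Set} {x y : A} (d : Dec (x ≡ y)) (f : A → ℕ) → 𝟙 d * f x ≡ 𝟙 d * f y
𝟙*-subst (yes refl) f = refl
𝟙*-subst (no _)     f = refl

extensions-suc : ∀ j k → extensions j (suc k) ≡ 𝟙 (j ℕP.≟ k) + (2 ^ suc k ∸ 1) * 𝟙 (j ℕP.≟ suc k)
extensions-suc j k =
  cong₂ _+_ (𝟙-cong (suc j ℕP.≟ suc k) (j ℕP.≟ k) ℕP.suc-injective (cong suc))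
            (trans (𝟙*-subst (j ℕP.≟ suc k) (λ i → 2 ^ i ∸ 1)) (ℕP.*-comm (𝟙 (j ℕP.≟ suc k)) _))

p-suc-zero : ∀ n → p (suc n) 0 ≡ 0
p-suc-zero n = trans (p-suc n 0) (∑-zero (allRels n) (λ A →
  trans (cong (_*_ (𝟙 (good? A))) (extensions-zero (numMinimal A))) (ℕP.*-zeroʳ (𝟙 (good? A)))))

p-suc-suc : ∀ n k → p (suc n) (suc k) ≡ p n k + (2 ^ suc k ∸ 1) * p n (suc k)
p-suc-suc n k = begin
  p (suc n) (suc k)
    ≡⟨ p-suc n (suc k) ⟩
  ∑ (allRels n) (λ A → 𝟙 (good? A) * extensions (numMinimal A) (suc k))
    ≡⟨ ∑-cong (allRels n) (λ A → trans (cong (_*_ (𝟙 (good? A))) (extensions-suc (numMinimal A) k))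
                                       (distrib (𝟙 (good? A)) _ C _)) ⟩
  ∑ (allRels n) (λ A → counted k A + C * counted (suc k) A)
    ≡⟨ ∑-+ (allRels n) _ _ ⟩
  ∑ (allRels n) (counted k) + ∑ (allRels n) (λ A → C * counted (suc k) A)
    ≡⟨ cong₂ _+_ (sym (p≡∑counted n k))
                 (trans (∑-*ˡ (allRels n) C _) (cong (_*_ C) (sym (p≡∑counted n (suc k))))) ⟩
  p n k + C * p n (suc k)
    ∎
  where
  open ≡-Reasoning
  C = 2 ^ suc k ∸ 1
  distrib : ∀ g a c b → g * (a + c * b) ≡ g * a + c * (g * b)
  distrib = solve-∀

p-zero-zero : p 0 0 ≡ 1
p-zero-zero = refl

p-<-zero : ∀ n k → n < k → p n k ≡ 0
p-<-zero zero    (suc k) _         = refl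
p-<-zero (suc n) (suc k) (s≤s n<k) = begin
  p (suc n) (suc k)
    ≡⟨ p-suc-suc n k ⟩
  p n k + (2 ^ suc k ∸ 1) * p n (suc k)
    ≡⟨ cong₂ (λ a b → a + (2 ^ suc k ∸ 1) * b)
             (p-<-zero n k n<k) (p-<-zero n (suc k) (ℕP.m<n⇒m<1+n n<k)) ⟩
  (2 ^ suc k ∸ 1) * 0
    ≡⟨ ℕP.*-zeroʳ (2 ^ suc k ∸ 1) ⟩
  0
    ∎
  where open ≡-Reasoning

[m]₂≡2^m∸1 : ∀ m → qint 2 m ≡ 2 ^ m ∸ 1
[m]₂≡2^m∸1 m = cong (_∸ 1) (suc-[m]₂ m)
  where
  suc-[m]₂ : ∀ m → suc (qint 2 m) ≡ 2 ^ m
  suc-[m]₂ zero    = refl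
  suc-[m]₂ (suc m) =
    trans (cong (_+ 2 ^ m) (suc-[m]₂ m)) (cong (_+_ (2 ^ m)) (sym (ℕP.+-identityʳ (2 ^ m))))

p≡S₂ : ∀ n k → p n k ≡ Sq 2 n k
p≡S₂ zero    zero    = refl
p≡S₂ zero    (suc k) = refl
p≡S₂ (suc n) zero    = p-suc-zero n
p≡S₂ (suc n) (suc k) = begin
  p (suc n) (suc k)
    ≡⟨ p-suc-suc n k ⟩
  p n k + (2 ^ suc k ∸ 1) * p n (suc k)
    ≡⟨ cong₂ (λ a b → a + b * p n (suc k)) (p≡S₂ n k) (sym ([m]₂≡2^m∸1 (suc k))) ⟩
  Sq 2 n k + qint 2 (suc k) * p n (suc k)
    ≡⟨ cong (λ a → Sq 2 n k + qint 2 (suc k) * a) (p≡S₂ n (suc k)) ⟩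
  Sq 2 (suc n) (suc k)
    ∎
  where open ≡-Reasoning

sumTo-cong : ∀ N {f g : ℕ → ℤ} → (∀ a → a ≤ N → f a ≡ g a) → sumTo N f ≡ sumTo N g
sumTo-cong zero    f≗g = f≗g 0 z≤n
sumTo-cong (suc N) f≗g =
  cong₂ ℤ._+_ (sumTo-cong N (λ a a≤N → f≗g a (ℕP.m≤n⇒m≤1+n a≤N))) (f≗g (suc N) ℕP.≤-refl)

sumTo-zero : ∀ N {f : ℕ → ℤ} → (∀ a → a ≤ N → f a ≡ 0ℤ) → sumTo N f ≡ 0ℤ
sumTo-zero zero    f≗0 = f≗0 0 z≤n
sumTo-zero (suc N) f≗0 =
  cong₂ ℤ._+_ (sumTo-zero N (λ a a≤N → f≗0 a (ℕP.m≤n⇒m≤1+n a≤N))) (f≗0 (suc N) ℕP.≤-refl)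

sumTo-sub : ∀ N (f g : ℕ → ℤ) → sumTo N (λ a → f a ℤ.- g a) ≡ sumTo N f ℤ.- sumTo N g
sumTo-sub zero    f g = refl
sumTo-sub (suc N) f g =
  trans (cong (ℤ._+ (f (suc N) ℤ.- g (suc N))) (sumTo-sub N f g))
        (interchange (sumTo N f) (sumTo N g) (f (suc N)) (g (suc N)))
  where
  interchange : ∀ a b c d → (a ℤ.- b) ℤ.+ (c ℤ.- d) ≡ (a ℤ.+ c) ℤ.- (b ℤ.+ d)
  interchange = solveℤ-∀

sumTo-*ˡ : ∀ N (c : ℤ) (f : ℕ → ℤ) → sumTo N (λ a → c ℤ.* f a) ≡ c ℤ.* sumTo N f
sumTo-*ˡ zero    c f = refl
sumTo-*ˡ (suc N) c f =
  trans (cong (ℤ._+ c ℤ.* f (suc N)) (sumTo-*ˡ N c f))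
        (sym (ℤP.*-distribˡ-+ c (sumTo N f) (f (suc N))))

sumTo-point-beyond : ∀ N c {f : ℕ → ℤ} → N < c → (∀ a → a ≢ c → f a ≡ 0ℤ) → sumTo N f ≡ 0ℤ
sumTo-point-beyond N c N<c f≗0 =
  sumTo-zero N (λ a a≤N → f≗0 a (λ { refl → ℕP.<⇒≱ N<c a≤N }))

sumTo-point : ∀ N c {f : ℕ → ℤ} → c ≤ N → (∀ a → a ≢ c → f a ≡ 0ℤ) → sumTo N f ≡ f c
sumTo-point zero    zero    z≤n f≗0 = refl
sumTo-point (suc N) c {f} c≤N f≗0 with c ℕP.≟ suc N
... | yes refl = trans (cong (ℤ._+ f (suc N)) (sumTo-point-beyond N (suc N) ℕP.≤-refl f≗0))
                       (ℤP.+-identityˡ (f (suc N)))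
... | no c≢N   = trans (cong₂ ℤ._+_ (sumTo-point N c (ℕP.≤-pred (ℕP.≤∧≢⇒< c≤N c≢N)) f≗0)
                                    (f≗0 (suc N) (c≢N ∘ sym)))
                       (ℤP.+-identityʳ (f c))

-- mono c d n m is definitionally  if does (n ≟ c) ∧ does (m ≟ d) then 1ℤ else 0ℤ.
mono-≢ : ∀ c d n m → n ≢ c ⊎ m ≢ d → mono c d n m ≡ 0ℤ
mono-≢ c d n m = off (n ℕP.≟ c) (m ℕP.≟ d)
  where
  off : (e₁ : Dec (n ≡ c)) (e₂ : Dec (m ≡ d)) → n ≢ c ⊎ m ≢ d →
        (if does e₁ ∧ does e₂ then 1ℤ else 0ℤ) ≡ 0ℤ
  off (yes n≡c) _         (inj₁ n≢c) = ⊥-elim (n≢c n≡c)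
  off (yes _)   (yes m≡d) (inj₂ m≢d) = ⊥-elim (m≢d m≡d)
  off (yes _)   (no _)    _          = refl
  off (no _)    _         _          = refl

mono-≡ : ∀ c d → mono c d c d ≡ 1ℤ
mono-≡ c d = on (c ℕP.≟ c) (d ℕP.≟ d)
  where
  on : (e₁ : Dec (c ≡ c)) (e₂ : Dec (d ≡ d)) → (if does e₁ ∧ does e₂ then 1ℤ else 0ℤ) ≡ 1ℤ
  on (yes _)  (yes _)  = refl
  on (yes _)  (no d≢d) = ⊥-elim (d≢d refl)
  on (no c≢c) _        = ⊥-elim (c≢c refl)

module _ (c d : ℕ) (g : PS2) (n m : ℕ) where

  private
    off-term : ∀ a b → a ≢ c ⊎ b ≢ d → mono c d a b ℤ.* g (n ∸ a) (m ∸ b) ≡ 0ℤ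
    off-term a b ne = cong (ℤ._* g (n ∸ a) (m ∸ b)) (mono-≢ c d a b ne)

  mono·-coeff : c ≤ n → d ≤ m → (mono c d ·₂ g) n m ≡ g (n ∸ c) (m ∸ d)
  mono·-coeff c≤n d≤m = begin
    (mono c d ·₂ g) n m
      ≡⟨ sumTo-point n c c≤n (λ a a≢c → sumTo-zero m (λ b _ → off-term a b (inj₁ a≢c))) ⟩
    sumTo m (λ b → mono c d c b ℤ.* g (n ∸ c) (m ∸ b))
      ≡⟨ sumTo-point m d d≤m (λ b b≢d → off-term c b (inj₂ b≢d)) ⟩
    mono c d c d ℤ.* g (n ∸ c) (m ∸ d)
      ≡⟨ trans (cong (ℤ._* g (n ∸ c) (m ∸ d)) (mono-≡ c d)) (ℤP.*-identityˡ _) ⟩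
    g (n ∸ c) (m ∸ d)
      ∎
    where open ≡-Reasoning

  mono·-coeff-< : n < c ⊎ m < d → (mono c d ·₂ g) n m ≡ 0ℤ
  mono·-coeff-< (inj₁ n<c) =
    sumTo-point-beyond n c n<c (λ a a≢c → sumTo-zero m (λ b _ → off-term a b (inj₁ a≢c)))
  mono·-coeff-< (inj₂ m<d) =
    sumTo-zero n (λ a _ → sumTo-point-beyond m d m<d (λ b b≢d → off-term a b (inj₂ b≢d)))

one₂·-coeff : ∀ (h : PS2) n m → (one₂ ·₂ h) n m ≡ h n m
one₂·-coeff h n m = mono·-coeff 0 0 h n m z≤n z≤n

z·-coeff-zero : ∀ (h : PS2) m → (z ·₂ h) 0 m ≡ 0ℤ
z·-coeff-zero h m = mono·-coeff-< 1 0 h 0 m (inj₁ (s≤s z≤n))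

z·-coeff-suc : ∀ (h : PS2) n m → (z ·₂ h) (suc n) m ≡ h n m
z·-coeff-suc h n m = mono·-coeff 1 0 h (suc n) m (s≤s z≤n) z≤n

y·-coeff-zero : ∀ (h : PS2) n → (y ·₂ h) n 0 ≡ 0ℤ
y·-coeff-zero h n = mono·-coeff-< 0 1 h n 0 (inj₂ (s≤s z≤n))

y·-coeff-suc : ∀ (h : PS2) n m → (y ·₂ h) n (suc m) ≡ h n m
y·-coeff-suc h n m = mono·-coeff 0 1 h n (suc m) z≤n (s≤s z≤n)

-₂-·₂-coeff : ∀ (f g h : PS2) n m → ((f -₂ g) ·₂ h) n m ≡ (f ·₂ h) n m ℤ.- (g ·₂ h) n m
-₂-·₂-coeff f g h n m =
  trans (sumTo-cong n (λ a _ → trans (sumTo-cong m (λ b _ → distrib (f a b) (g a b) (h (n ∸ a) (m ∸ b))))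
                                     (sumTo-sub m _ _)))
        (sumTo-sub n _ _)
  where
  distrib : ∀ (u v w : ℤ) → (u ℤ.- v) ℤ.* w ≡ u ℤ.* w ℤ.- v ℤ.* w
  distrib = solveℤ-∀

[1-y]·-coeff : ∀ (h : PS2) n m → ((one₂ -₂ y) ·₂ h) n m ≡ h n m ℤ.- (y ·₂ h) n m
[1-y]·-coeff h n m =
  trans (-₂-·₂-coeff one₂ y h n m) (cong (ℤ._- (y ·₂ h) n m) (one₂·-coeff h n m))

pos-^ : ∀ a m → (+ a) ℤ.^ m ≡ + (a ^ m)
pos-^ a zero    = refl
pos-^ a (suc m) = trans (cong (ℤ._*_ (+ a)) (pos-^ a m)) (sym (ℤP.pos-* a (a ^ m)))

pos-∸1 : ∀ {a} → 1 ≤ a → + (a ∸ 1) ≡ + a ℤ.- 1ℤ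
pos-∸1 {a} 1≤a = sym (trans (ℤP.m-n≡m⊖n a 1) (ℤP.⊖-≥ 1≤a))

F-suc-suc : ∀ n k → F (suc n) (suc k) ≡ F n k ℤ.+ (+ (2 ^ suc k) ℤ.- 1ℤ) ℤ.* F n (suc k)
F-suc-suc n k = begin
  + p (suc n) (suc k)
    ≡⟨ cong +_ (p-suc-suc n k) ⟩
  + (p n k + C * p n (suc k))
    ≡⟨ ℤP.pos-+ (p n k) (C * p n (suc k)) ⟩
  F n k ℤ.+ + (C * p n (suc k))
    ≡⟨ cong (ℤ._+_ (F n k)) (ℤP.pos-* C (p n (suc k))) ⟩
  F n k ℤ.+ + C ℤ.* F n (suc k)
    ≡⟨ cong (λ c → F n k ℤ.+ c ℤ.* F n (suc k)) (pos-∸1 (ℕP.m^n>0 2 (suc k))) ⟩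
  F n k ℤ.+ (+ (2 ^ suc k) ℤ.- 1ℤ) ℤ.* F n (suc k)
    ∎
  where
  open ≡-Reasoning
  C = 2 ^ suc k ∸ 1

-- The series F(z, 2y) − (1 − y) F(z, y), so that the functional equation reads F = 1 + z H.
H : PS2
H = substY (+ 2) F -₂ ((one₂ -₂ y) ·₂ F)

F-suc≡H : ∀ n k → F (suc n) k ≡ H n k
F-suc≡H n zero = begin
  + p (suc n) 0
    ≡⟨ cong +_ (p-suc-zero n) ⟩
  0ℤ
    ≡⟨ cancel (F n 0) ⟩
  1ℤ ℤ.* F n 0 ℤ.- (F n 0 ℤ.- 0ℤ)
    ≡⟨ cong (λ t → 1ℤ ℤ.* F n 0 ℤ.- (F n 0 ℤ.- t)) (sym (y·-coeff-zero F n)) ⟩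
  1ℤ ℤ.* F n 0 ℤ.- (F n 0 ℤ.- (y ·₂ F) n 0)
    ≡⟨ cong (ℤ._-_ (1ℤ ℤ.* F n 0)) (sym ([1-y]·-coeff F n 0)) ⟩
  H n 0
    ∎
  where
  open ≡-Reasoning
  cancel : ∀ x → 0ℤ ≡ 1ℤ ℤ.* x ℤ.- (x ℤ.- 0ℤ)
  cancel = solveℤ-∀
F-suc≡H n (suc k) = begin
  F (suc n) (suc k)
    ≡⟨ F-suc-suc n k ⟩
  F n k ℤ.+ (+ (2 ^ suc k) ℤ.- 1ℤ) ℤ.* x
    ≡⟨ cong (λ t → F n k ℤ.+ (t ℤ.- 1ℤ) ℤ.* x) (sym (pos-^ 2 (suc k))) ⟩
  F n k ℤ.+ ((+ 2) ℤ.^ suc k ℤ.- 1ℤ) ℤ.* x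
    ≡⟨ rearrange (F n k) ((+ 2) ℤ.^ suc k) x ⟩
  (+ 2) ℤ.^ suc k ℤ.* x ℤ.- (x ℤ.- F n k)
    ≡⟨ cong (λ t → (+ 2) ℤ.^ suc k ℤ.* x ℤ.- (x ℤ.- t)) (sym (y·-coeff-suc F n k)) ⟩
  (+ 2) ℤ.^ suc k ℤ.* x ℤ.- (x ℤ.- (y ·₂ F) n (suc k))
    ≡⟨ cong (ℤ._-_ ((+ 2) ℤ.^ suc k ℤ.* x)) (sym ([1-y]·-coeff F n (suc k))) ⟩
  H n (suc k)
    ∎
  where
  open ≡-Reasoning
  x = F n (suc k)
  rearrange : ∀ a q x → a ℤ.+ (q ℤ.- 1ℤ) ℤ.* x ≡ q ℤ.* x ℤ.- (x ℤ.- a)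
  rearrange = solveℤ-∀

F-functional-equation : ∀ n k → F n k ≡ (one₂ +₂ (z ·₂ H)) n k
F-functional-equation zero k =
  trans (F-zero k)
        (sym (trans (cong (ℤ._+_ (one₂ 0 k)) (z·-coeff-zero H k)) (ℤP.+-identityʳ (one₂ 0 k))))
  where
  F-zero : ∀ k → F 0 k ≡ one₂ 0 k
  F-zero zero    = refl
  F-zero (suc k) = refl
F-functional-equation (suc n) k =
  trans (F-suc≡H n k) (sym (trans (cong (ℤ._+_ 0ℤ) (z·-coeff-suc H n k)) (ℤP.+-identityˡ (H n k))))

·₁-invOneMinus-suc : ∀ (f : PS1) (a : ℤ) j →
  (f ·₁ invOneMinus a) (suc j) ≡ f (suc j) ℤ.+ a ℤ.* (f ·₁ invOneMinus a) j
·₁-invOneMinus-suc f a j = begin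
  sumTo j (λ i → f i ℤ.* a ℤ.^ (suc j ∸ i)) ℤ.+ f (suc j) ℤ.* a ℤ.^ (suc j ∸ suc j)
    ≡⟨ cong₂ ℤ._+_ (sumTo-cong j (λ i i≤j → trans (cong (λ e → f i ℤ.* a ℤ.^ e) (ℕP.+-∸-assoc 1 i≤j))
                                                   (swap (f i) a (a ℤ.^ (j ∸ i)))))
                   (trans (cong (λ e → f (suc j) ℤ.* a ℤ.^ e) (ℕP.n∸n≡0 j))
                          (ℤP.*-identityʳ (f (suc j)))) ⟩
  sumTo j (λ i → a ℤ.* (f i ℤ.* a ℤ.^ (j ∸ i))) ℤ.+ f (suc j)
    ≡⟨ cong (ℤ._+ f (suc j)) (sumTo-*ˡ j a _) ⟩
  a ℤ.* (f ·₁ invOneMinus a) j ℤ.+ f (suc j)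
    ≡⟨ ℤP.+-comm _ (f (suc j)) ⟩
  f (suc j) ℤ.+ a ℤ.* (f ·₁ invOneMinus a) j
    ∎
  where
  open ≡-Reasoning
  swap : ∀ u a v → u ℤ.* (a ℤ.* v) ≡ a ℤ.* (u ℤ.* v)
  swap = solveℤ-∀

-- Along the diagonal n = k + j the recurrence is exactly that of the coefficients of prodInv k.
F-diagonal : ∀ k j → F (k + j) k ≡ prodInv k j
F-diagonal zero    zero    = refl
F-diagonal zero    (suc j) = cong +_ (p-suc-zero j)
F-diagonal (suc k) zero    = begin
  F (suc (k + 0)) (suc k)
    ≡⟨ F-suc-suc (k + 0) k ⟩
  F (k + 0) k ℤ.+ (+ (2 ^ suc k) ℤ.- 1ℤ) ℤ.* + p (k + 0) (suc k)
    ≡⟨ cong (λ t → F (k + 0) k ℤ.+ (+ (2 ^ suc k) ℤ.- 1ℤ) ℤ.* + t) (p-<-zero (k + 0) (suc k) k+0<1+k) ⟩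
  F (k + 0) k ℤ.+ (+ (2 ^ suc k) ℤ.- 1ℤ) ℤ.* 0ℤ
    ≡⟨ trans (cong (ℤ._+_ (F (k + 0) k)) (ℤP.*-zeroʳ (+ (2 ^ suc k) ℤ.- 1ℤ)))
             (ℤP.+-identityʳ (F (k + 0) k)) ⟩
  F (k + 0) k
    ≡⟨ F-diagonal k 0 ⟩
  prodInv k 0
    ≡⟨ sym (ℤP.*-identityʳ (prodInv k 0)) ⟩
  prodInv (suc k) 0
    ∎
  where
  open ≡-Reasoning
  k+0<1+k : k + 0 < suc k
  k+0<1+k = s≤s (ℕP.≤-reflexive (ℕP.+-identityʳ k))
F-diagonal (suc k) (suc j) = begin
  F (suc (k + suc j)) (suc k)
    ≡⟨ F-suc-suc (k + suc j) k ⟩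
  F (k + suc j) k ℤ.+ α ℤ.* F (k + suc j) (suc k)
    ≡⟨ cong₂ (λ s t → s ℤ.+ α ℤ.* t) (F-diagonal k (suc j))
             (trans (cong (λ n → F n (suc k)) (ℕP.+-suc k j)) (F-diagonal (suc k) j)) ⟩
  prodInv k (suc j) ℤ.+ α ℤ.* prodInv (suc k) j
    ≡⟨ sym (·₁-invOneMinus-suc (prodInv k) α j) ⟩
  prodInv (suc k) (suc j)
    ∎
  where
  open ≡-Reasoning
  α = + (2 ^ suc k) ℤ.- 1ℤ

G-coeff : ∀ n k → G n k ≡ (mono k k ·₂ embZ (prodInv k)) n k
G-coeff n k = sumTo-point (n + k) k (ℕP.m≤n+m k n) off-diagonal
  where
  off-diagonal : ∀ i → i ≢ k → (mono i i ·₂ embZ (prodInv i)) n k ≡ 0ℤ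
  off-diagonal i i≢k with i ℕP.≤? n | i ℕP.≤? k
  ... | no i≰n  | _       = mono·-coeff-< i i (embZ (prodInv i)) n k (inj₁ (ℕP.≰⇒> i≰n))
  ... | yes _   | no i≰k  = mono·-coeff-< i i (embZ (prodInv i)) n k (inj₂ (ℕP.≰⇒> i≰k))
  ... | yes i≤n | yes i≤k =
    trans (mono·-coeff i i (embZ (prodInv i)) n k i≤n i≤k) (embZ-off (k ∸ i) refl)
    where
    embZ-off : ∀ b → k ∸ i ≡ b → embZ (prodInv i) (n ∸ i) b ≡ 0ℤ
    embZ-off zero    k∸i≡0 = ⊥-elim (i≢k (ℕP.≤-antisym i≤k (ℕP.m∸n≡0⇒m≤n k∸i≡0)))
    embZ-off (suc b) _     = refl

F≡G : ∀ n k → F n k ≡ G n k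
F≡G n k with k ℕP.≤? n
... | yes k≤n = begin
  F n k                               ≡⟨ cong (λ m → F m k) (sym (ℕP.m+[n∸m]≡n k≤n)) ⟩
  F (k + (n ∸ k)) k                   ≡⟨ F-diagonal k (n ∸ k) ⟩
  embZ (prodInv k) (n ∸ k) 0          ≡⟨ cong (embZ (prodInv k) (n ∸ k)) (sym (ℕP.n∸n≡0 k)) ⟩
  embZ (prodInv k) (n ∸ k) (k ∸ k)    ≡⟨ sym (mono·-coeff k k (embZ (prodInv k)) n k k≤n ℕP.≤-refl) ⟩
  (mono k k ·₂ embZ (prodInv k)) n k  ≡⟨ sym (G-coeff n k) ⟩
  G n k                               ∎
  where open ≡-Reasoning
... | no k≰n = trans (cong +_ (p-<-zero n k n<k))
                     (sym (trans (G-coeff n k) (mono·-coeff-< k k (embZ (prodInv k)) n k (inj₁ n<k))))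
  where
  n<k : n < k
  n<k = ℕP.≰⇒> k≰n

proposition2p3 :
    (p 0 0 ≡ 1) ×
    (∀ n → p (suc n) 0 ≡ 0) ×
    (∀ n k → n < k → p n k ≡ 0) ×
    (∀ n k → p (suc n) (suc k) ≡ p n k + (2 ^ suc k ∸ 1) * p n (suc k)) ×
    (∀ n k → p n k ≡ Sq 2 n k) ×
    (∀ n k → F n k ≡ (one₂ +₂ (z ·₂ (substY (+ 2) F -₂ ((one₂ -₂ y) ·₂ F)))) n k) ×
    (∀ n k → F n k ≡ G n k)
proposition2p3 =
  p-zero-zero , p-suc-zero , p-<-zero , p-suc-suc , p≡S₂ , F-functional-equation , F≡G
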